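{- For every integer $n\geqslant 0$, $$A_{n+1}(x,y,s)=\sum_{i=0}^n\binom{n}{i}A_i(x,y)\,C_{n-i}(x,y,s),\qquad A_{n+1}(x,y,-y)=\sum_{i=0}^n\binom{n}{i}d_i(x,y)\,d_{n-i}(x,y).$$ In particular, $$A_{n+1}(x,1,0)=\sum_{i=0}^n\binom{n}{i}A_i(x)d_{n-i}(x),\qquad A_{n+1}(x,1,1)=\sum_{i=0}^n\binom{n}{i}A_i(x)A_{n-i}(x).$$
   Context: For $\pi\in\mathfrak{S}_n$ (permutations of $[n]$ written $\pi(1)\cdots\pi(n)$): ${\rm des}(\pi)=\#\{i\in[n-1]:\pi(i)>\pi(i+1)\}$; ${\rm suc}(\pi)=\#\{i\in[n-1]:\pi(i+1)=\pi(i)+1\}$; ${\rm basc}(\pi)=\#\{i\in[n-1]:\pi(i+1)\geqslant\pi(i)+2\}$; ${\rm exc}(\pi)=\#\{i:\pi(i)>i\}$, ${\rm drop}(\pi)=\#\{i:\pi(i)<i\}$, ${\rm fix}(\pi)=\#\{i:\pi(i)=i\}$. Define $A_n(x,y,s)=\sum_{\pi\in\mathfrak{S}_n}x^{{\rm basc}(\pi)}y^{{\rm des}(\pi)}s^{{\rm suc}(\pi)}$ for $n\ge1$; $C_n(x,y,s)=\sum_{\pi\in\mathfrak{S}_n}x^{{\rm exc}(\pi)}y^{{\rm drop}(\pi)}s^{{\rm fix}(\pi)}$; $A_n(x,y)=C_n(x,y,y)=\sum_{\pi\in\mathfrak{S}_n}x^{{\rm exc}(\pi)}y^{{\rm drop}(\pi)+{\rm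 fix}(\pi)}$; $d_n(x,y)=\sum_{\pi\in\mathcal{D}_n}x^{{\rm exc}(\pi)}y^{{\rm drop}(\pi)}$ where $\mathcal{D}_n$ is the set of derangements (permutations without fixed points) in $\mathfrak{S}_n$; $A_n(x)=\sum_{\pi\in\mathfrak{S}_n}x^{{\rm des}(\pi)}$ (Eulerian polynomial), $d_n(x)=\sum_{\pi\in\mathcal{D}_n}x^{{\rm exc}(\pi)}$ (derangement polynomial). For $n=0$ all of $C_0,A_0(x,y),d_0(x,y),A_0(x),d_0(x)$ equal $1$. -}

module Defs where

open import Data.Nat as ℕ using (ℕ; zero; suc; _<ᵇ_; _≡ᵇ_)
open import Data.Nat.Combinatorics using (_C_)
open import Data.Bool using (Bool; true; false; if_then_else_)
open import Data.List using (List; []; _∷_; map; concatMap; upTo; foldr)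
open import Data.Integer using (ℤ; +_; _+_; _*_; _^_; -_)

-- Permutations of [n] = {1,…,n}, written in one-line notation π(1)⋯π(n)
-- as a list of natural numbers.  All permutations of [n+1] are obtained
-- (each exactly once) by inserting n+1 at every position of every
-- permutation of [n].

insertAll : ℕ → List ℕ → List (List ℕ)
insertAll a []       = (a ∷ []) ∷ []
insertAll a (b ∷ bs) = (a ∷ b ∷ bs) ∷ map (b ∷_) (insertAll a bs)

perms : ℕ → List (List ℕ)
perms zero    = [] ∷ []
perms (suc n) = concatMap (insertAll (suc n)) (perms n)

b2n : Bool → ℕ
b2n true  = 1
b2n false = 0

countAdj : (ℕ → ℕ → Bool) → List ℕ → ℕ
countAdj p []           = 0
countAdj p (a ∷ [])     = 0
countAdj p (a ∷ b ∷ bs) = b2n (p a b) ℕ.+ countAdj p (b ∷ bs)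

des suc' basc : List ℕ → ℕ
des   = countAdj (λ a b → b <ᵇ a)
suc'  = countAdj (λ a b → b ≡ᵇ suc a)
basc  = countAdj (λ a b → suc a <ᵇ b)

countPos : (ℕ → ℕ → Bool) → ℕ → List ℕ → ℕ
countPos p k []       = 0
countPos p k (a ∷ as) = b2n (p a k) ℕ.+ countPos p (suc k) as

exc drop fix : List ℕ → ℕ
exc  = countPos (λ a i → i <ᵇ a) 1
drop = countPos (λ a i → a <ᵇ i) 1
fix  = countPos (λ a i → a ≡ᵇ i) 1

sumℤ : List ℤ → ℤ
sumℤ = foldr _+_ (+ 0)

-- Polynomials are represented by their evaluation at integer points.

A3 : ℕ → ℤ → ℤ → ℤ → ℤ
A3 n x y s = sumℤ (map (λ π → x ^ basc π * y ^ des π * s ^ suc' π) (perms n))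

C3 : ℕ → ℤ → ℤ → ℤ → ℤ
C3 n x y s = sumℤ (map (λ π → x ^ exc π * y ^ drop π * s ^ fix π) (perms n))

A2 : ℕ → ℤ → ℤ → ℤ
A2 n x y = sumℤ (map (λ π → x ^ exc π * y ^ (drop π ℕ.+ fix π)) (perms n))

d2 : ℕ → ℤ → ℤ → ℤ
d2 n x y = sumℤ (map (λ π → if fix π ≡ᵇ 0 then x ^ exc π * y ^ drop π else + 0) (perms n))

A1 : ℕ → ℤ → ℤ
A1 n x = sumℤ (map (λ π → x ^ des π) (perms n))

d1 : ℕ → ℤ → ℤ
d1 n x = sumℤ (map (λ π → if fix π ≡ᵇ 0 then x ^ exc π else + 0) (perms n))

binomConv : ℕ → (ℕ → ℤ) → (ℕ → ℤ) → ℤ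
binomConv n f g = sumℤ (map (λ i → + (n C i) * f i * g (n ℕ.∸ i)) (upTo (suc n)))

-- The statistics of permutations are handled through transposes: a weight H : ℕ → ℕ → ℕ → ℤ is
-- sent to Σ_π H (stat π), and the weight x^p y^q s^r gives back the generating polynomial.
-- Multiplication by x^e y^r becomes a shift of H, and the derivation D = xy(∂ₓ + ∂ᵧ + ∂ₛ)
-- becomes ∂. Inserting n + 1 into the permutations of [n], in all slots of the word for
-- (basc, des, suc) and in all cycles for (exc, drop, fix), gives A_{n+1} = (y + s + D) A_n and
-- C_{n+1} = (s + D) C_n, hence A_n(x,y) = C_n(x,y,y) = (y + D)^n 1. As D is a derivation,
-- (y + s + D)^n (1 · 1) = Σ_i C(n,i) (y + D)^i 1 · (s + D)^(n-i) 1, the first identity.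
-- Since ∂ₛ commutes with D, ∂ₛ C_n = n C_{n-1}, so C_n(x,y,s) = Σ_k C(n,k) s^k d_{n-k}(x,y):
-- for binomial convolution C(s) = e^s d, and A(x,y) C(x,y,-y) = e^y d e^(-y) d = d d.
-- The last two identities specialise the first, exc and des being equidistributed because
-- (exc, drop + fix) and (des, 1 + asc) satisfy the same recurrence.

module Submission where

open import Defs
open import Function using (_∘_)
open import Data.Empty using (⊥-elim)
open import Data.Nat as ℕ using (ℕ; zero; suc; pred; _∸_; _≤_; _<_; _<ᵇ_; _≡ᵇ_; z≤n; s≤s; _<?_; _≟_)
import Data.Nat.Properties as ℕ
open import Data.Nat.Combinatorics using (_C_; nCk+nC[k+1]≡[n+1]C[k+1]; k>n⇒nCk≡0; nC1≡n)
open import Data.Integer as ℤ using (ℤ; +_; -_; _+_; _*_; _^_)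
import Data.Integer.Properties as ℤ
open import Data.Integer.Tactic.RingSolver using (solve-∀)
open import Data.Nat.Tactic.RingSolver using () renaming (solve-∀ to ℕ-solve-∀)
open import Data.List using (List; []; _∷_; map; concatMap; _++_; _∷ʳ_; reverse; upTo; applyUpTo; applyDownFrom; length)
import Data.List.Properties as List
open import Data.List.Membership.Propositional using (_∈_; find; lose)
open import Data.List.Membership.Propositional.Properties using (∈-map⁺; ∈-map⁻; ∈-∃++; ∈-concatMap⁺; ∈-concatMap⁻)
open import Data.List.Relation.Unary.Any using (here; there)
open import Data.List.Relation.Unary.All as All using (All; []; _∷_)
import Data.List.Relation.Unary.All.Properties as AllProps
open import Data.List.Relation.Unary.AllPairs using ([]; _∷_)
open import Data.List.Relation.Unary.Unique.Propositional using (Unique)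
import Data.List.Relation.Unary.Unique.Propositional.Properties as Unique
open import Data.List.Relation.Binary.Permutation.Propositional using (_↭_; ↭⇒↭ₛ; ↭-refl; ↭-sym; ↭-trans; prep; swap)
import Data.List.Relation.Binary.Permutation.Propositional.Properties as ↭
open import Data.List.Relation.Binary.Permutation.Setoid.Properties using (foldr-commMonoid)
import Data.List.Relation.Binary.Permutation.Setoid.Properties as ↭ₛ
open import Data.Bool using (true; false; if_then_else_)
open import Data.Product using (_×_; _,_)
open import Relation.Nullary using (¬_; yes; no)
open import Relation.Nullary.Decidable using (dec-true; dec-false)
open import Relation.Binary using (tri<; tri≈; tri>)
open import Relation.Binary.PropositionalEquality
open import Algebra.Bundles using (CommutativeMonoid)
open import Algebra.Properties.CommutativeSemigroup ℤ.+-commutativeSemigroup using (interchange; x∙yz≈y∙xz)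
import Algebra.Properties.CommutativeSemigroup ℕ.+-commutativeSemigroup as ℕ+
open ≡-Reasoning

-- Finite sums

private
  variable
    A B : Set

sumMap : (A → ℤ) → List A → ℤ
sumMap f xs = sumℤ (map f xs)

sumMap-++ : (f : A → ℤ) (xs ys : List A) → sumMap f (xs ++ ys) ≡ sumMap f xs + sumMap f ys
sumMap-++ f []       ys = sym (ℤ.+-identityˡ _)
sumMap-++ f (x ∷ xs) ys = trans (cong (_+_ (f x)) (sumMap-++ f xs ys)) (sym (ℤ.+-assoc (f x) _ _))

sumMap-concatMap : (f : B → ℤ) (g : A → List B) (xs : List A) →
                   sumMap f (concatMap g xs) ≡ sumMap (sumMap f ∘ g) xs
sumMap-concatMap f g []       = refl
sumMap-concatMap f g (x ∷ xs) =
  trans (sumMap-++ f (g x) (concatMap g xs)) (cong (_+_ (sumMap f (g x))) (sumMap-concatMap f g xs))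

sumMap-map : (f : B → ℤ) (g : A → B) (xs : List A) → sumMap f (map g xs) ≡ sumMap (f ∘ g) xs
sumMap-map f g xs = cong sumℤ (sym (List.map-∘ xs))

sumMap-cong : {f g : A → ℤ} → (∀ x → f x ≡ g x) → (xs : List A) → sumMap f xs ≡ sumMap g xs
sumMap-cong f≗g xs = cong sumℤ (List.map-cong f≗g xs)

sumMap-cong-∈ : {f g : A → ℤ} (xs : List A) → (∀ {x} → x ∈ xs → f x ≡ g x) → sumMap f xs ≡ sumMap g xs
sumMap-cong-∈ xs f≗g = cong sumℤ (List.map-cong-local (All.tabulate f≗g))

sumMap-+ : (f g : A → ℤ) (xs : List A) → sumMap (λ x → f x + g x) xs ≡ sumMap f xs + sumMap g xs
sumMap-+ f g []       = refl
sumMap-+ f g (x ∷ xs) = trans (cong (_+_ (f x + g x)) (sumMap-+ f g xs)) (interchange (f x) (g x) _ _)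

sumMap-* : (c : ℤ) (f : A → ℤ) (xs : List A) → sumMap (λ x → c * f x) xs ≡ c * sumMap f xs
sumMap-* c f []       = sym (ℤ.*-zeroʳ c)
sumMap-* c f (x ∷ xs) = trans (cong (_+_ (c * f x)) (sumMap-* c f xs)) (sym (ℤ.*-distribˡ-+ c (f x) _))

sumMap-↭ : (f : A → ℤ) {xs ys : List A} → xs ↭ ys → sumMap f xs ≡ sumMap f ys
sumMap-↭ f p = foldr-commMonoid ℤ+.setoid ℤ+.isCommutativeMonoid (↭⇒↭ₛ (↭.map⁺ f p))
  where module ℤ+ = CommutativeMonoid ℤ.+-0-commutativeMonoid

sumTo : ℕ → (ℕ → ℤ) → ℤ
sumTo zero    f = + 0
sumTo (suc m) f = f 0 + sumTo m (f ∘ suc)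

sumMap-applyUpTo : ∀ m (f : ℕ → ℤ) (g : ℕ → ℕ) → sumMap f (applyUpTo g m) ≡ sumTo m (f ∘ g)
sumMap-applyUpTo zero    f g = refl
sumMap-applyUpTo (suc m) f g = cong (_+_ (f (g 0))) (sumMap-applyUpTo m f (g ∘ suc))

sumTo-cong : ∀ m {f g : ℕ → ℤ} → (∀ i → i < m → f i ≡ g i) → sumTo m f ≡ sumTo m g
sumTo-cong zero    f≗g = refl
sumTo-cong (suc m) f≗g = cong₂ _+_ (f≗g 0 (s≤s z≤n)) (sumTo-cong m (λ i i<m → f≗g (suc i) (s≤s i<m)))

sumTo-+ : ∀ m (f g : ℕ → ℤ) → sumTo m (λ i → f i + g i) ≡ sumTo m f + sumTo m g
sumTo-+ zero    f g = refl
sumTo-+ (suc m) f g = trans (cong (_+_ (f 0 + g 0)) (sumTo-+ m (f ∘ suc) (g ∘ suc))) (interchange (f 0) (g 0) _ _)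

sumTo-snoc : ∀ m (f : ℕ → ℤ) → sumTo (suc m) f ≡ sumTo m f + f m
sumTo-snoc zero    f = ℤ.+-comm (f 0) (+ 0)
sumTo-snoc (suc m) f = trans (cong (_+_ (f 0)) (sumTo-snoc m (f ∘ suc))) (sym (ℤ.+-assoc (f 0) _ _))

sumTo-zero : ∀ m → sumTo m (λ _ → + 0) ≡ + 0
sumTo-zero zero    = refl
sumTo-zero (suc m) = trans (ℤ.+-identityˡ _) (sumTo-zero m)

sumTo-δ : ∀ {f n} (a : ℕ → ℤ) → f ≤ n → sumTo (suc n) (λ k → if f ≡ᵇ k then a k else + 0) ≡ a f
sumTo-δ {zero}  {n}     a z≤n       = trans (cong (_+_ (a 0)) (sumTo-zero n)) (ℤ.+-identityʳ (a 0))
sumTo-δ {suc f} {suc n} a (s≤s f≤n) = trans (ℤ.+-identityˡ _) (sumTo-δ (a ∘ suc) f≤n)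

sumMap-sumTo : ∀ (F : A → ℕ → ℤ) m xs → sumMap (λ x → sumTo m (F x)) xs ≡ sumTo m (λ k → sumMap (λ x → F x k) xs)
sumMap-sumTo F m []       = sym (sumTo-zero m)
sumMap-sumTo F m (x ∷ xs) = trans (cong (_+_ (sumTo m (F x))) (sumMap-sumTo F m xs)) (sym (sumTo-+ m (F x) _))

-- Binomial convolution

[k+1]*[n+1]C[k+1]≡[n+1]*nCk : ∀ n k → suc k ℕ.* (suc n C suc k) ≡ suc n ℕ.* (n C k)
[k+1]*[n+1]C[k+1]≡[n+1]*nCk n       zero    =
  trans (ℕ.+-identityʳ _) (trans (nC1≡n (suc n)) (sym (ℕ.*-identityʳ (suc n))))
[k+1]*[n+1]C[k+1]≡[n+1]*nCk zero    (suc k)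
  rewrite k>n⇒nCk≡0 {1} {suc (suc k)} (s≤s (s≤s z≤n)) | k>n⇒nCk≡0 {0} {suc k} (s≤s z≤n) = ℕ.*-zeroʳ (suc (suc k))
[k+1]*[n+1]C[k+1]≡[n+1]*nCk (suc n) (suc k) = begin
  suc (suc k) ℕ.* (suc (suc n) C suc (suc k))
    ≡⟨ cong (suc (suc k) ℕ.*_) (sym (nCk+nC[k+1]≡[n+1]C[k+1] (suc n) (suc k))) ⟩
  suc (suc k) ℕ.* (a ℕ.+ b)
    ≡⟨ spread k a b ⟩
  a ℕ.+ (suc k ℕ.* a ℕ.+ suc (suc k) ℕ.* b)
    ≡⟨ cong₂ (λ u v → a ℕ.+ (u ℕ.+ v)) ([k+1]*[n+1]C[k+1]≡[n+1]*nCk n k) ([k+1]*[n+1]C[k+1]≡[n+1]*nCk n (suc k)) ⟩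
  a ℕ.+ (suc n ℕ.* (n C k) ℕ.+ suc n ℕ.* (n C suc k))
    ≡⟨ cong (a ℕ.+_) (sym (ℕ.*-distribˡ-+ (suc n) (n C k) (n C suc k))) ⟩
  a ℕ.+ suc n ℕ.* (n C k ℕ.+ n C suc k)
    ≡⟨ cong (λ c → a ℕ.+ suc n ℕ.* c) (nCk+nC[k+1]≡[n+1]C[k+1] n k) ⟩
  suc (suc n) ℕ.* a ∎
  where
  a b : ℕ
  a = suc n C suc k
  b = suc n C suc (suc k)
  spread : ∀ k a b → suc (suc k) ℕ.* (a ℕ.+ b) ≡ a ℕ.+ (suc k ℕ.* a ℕ.+ suc (suc k) ℕ.* b)
  spread = ℕ-solve-∀

binomSum : ℕ → (ℕ → ℕ → ℤ) → ℤ
binomSum n F = sumTo (suc n) (λ i → + (n C i) * F i (n ∸ i))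

binomConv≡binomSum : ∀ n f g → binomConv n f g ≡ binomSum n (λ i j → f i * g j)
binomConv≡binomSum n f g = trans (sumMap-applyUpTo (suc n) (λ i → + (n C i) * f i * g (n ∸ i)) (λ i → i))
  (sumTo-cong (suc n) (λ i _ → ℤ.*-assoc (+ (n C i)) (f i) (g (n ∸ i))))

binomSum-cong : ∀ n {F G : ℕ → ℕ → ℤ} → (∀ i j → F i j ≡ G i j) → binomSum n F ≡ binomSum n G
binomSum-cong n F≗G = sumTo-cong (suc n) (λ i _ → cong (_*_ (+ (n C i))) (F≗G i (n ∸ i)))

binomSum-+ : ∀ n (F G : ℕ → ℕ → ℤ) → binomSum n (λ i j → F i j + G i j) ≡ binomSum n F + binomSum n G
binomSum-+ n F G = trans (sumTo-cong (suc n) (λ i _ → ℤ.*-distribˡ-+ (+ (n C i)) (F i (n ∸ i)) (G i (n ∸ i))))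
  (sumTo-+ (suc n) (λ i → + (n C i) * F i (n ∸ i)) (λ i → + (n C i) * G i (n ∸ i)))

binomSum-suc : ∀ n F → binomSum (suc n) F ≡ binomSum n (λ i j → F (suc i) j + F i (suc j))
binomSum-suc n F = begin
  U 0 + sumTo (suc n) (λ i → + (suc n C suc i) * F (suc i) (n ∸ i))
    ≡⟨ cong (_+_ (U 0)) (trans (sumTo-cong (suc n) (λ i _ → pascal i)) (sumTo-+ (suc n) T V)) ⟩
  U 0 + (sumTo (suc n) T + sumTo (suc n) V)
    ≡⟨ x∙yz≈y∙xz (U 0) (sumTo (suc n) T) _ ⟩
  sumTo (suc n) T + (U 0 + sumTo (suc n) V)
    ≡⟨ cong (λ z → sumTo (suc n) T + (U 0 + z)) shiftV ⟩
  sumTo (suc n) T + sumTo (suc n) U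
    ≡⟨ sym (binomSum-+ n (λ i j → F (suc i) j) (λ i j → F i (suc j))) ⟩
  binomSum n (λ i j → F (suc i) j + F i (suc j)) ∎
  where
  T U V : ℕ → ℤ
  T i = + (n C i) * F (suc i) (n ∸ i)
  U i = + (n C i) * F i (suc (n ∸ i))
  V i = + (n C suc i) * F (suc i) (n ∸ i)
  pascal : ∀ i → + (suc n C suc i) * F (suc i) (n ∸ i) ≡ T i + V i
  pascal i = begin
    + (suc n C suc i) * F (suc i) (n ∸ i)
      ≡⟨ cong (λ c → + c * F (suc i) (n ∸ i)) (sym (nCk+nC[k+1]≡[n+1]C[k+1] n i)) ⟩
    + (n C i ℕ.+ n C suc i) * F (suc i) (n ∸ i)
      ≡⟨ ℤ.*-distribʳ-+ (F (suc i) (n ∸ i)) (+ (n C i)) (+ (n C suc i)) ⟩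
    T i + V i ∎
  shiftV : sumTo (suc n) V ≡ sumTo n (U ∘ suc)
  shiftV = begin
    sumTo (suc n) V
      ≡⟨ sumTo-snoc n V ⟩
    sumTo n V + V n
      ≡⟨ cong (λ c → sumTo n V + + c * F (suc n) (n ∸ n)) (k>n⇒nCk≡0 (ℕ.n<1+n n)) ⟩
    sumTo n V + + 0
      ≡⟨ ℤ.+-identityʳ _ ⟩
    sumTo n V
      ≡⟨ sumTo-cong n (λ i i<n → cong (λ j → + (n C suc i) * F (suc i) j) (ℕ.+-∸-assoc 1 i<n)) ⟩
    sumTo n (U ∘ suc) ∎

binomConv-suc : ∀ n f g → binomConv (suc n) f g ≡ binomConv n (f ∘ suc) g + binomConv n f (g ∘ suc)
binomConv-suc n f g = begin
  binomConv (suc n) f g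
    ≡⟨ binomConv≡binomSum (suc n) f g ⟩
  binomSum (suc n) (λ i j → f i * g j)
    ≡⟨ binomSum-suc n (λ i j → f i * g j) ⟩
  binomSum n (λ i j → f (suc i) * g j + f i * g (suc j))
    ≡⟨ binomSum-+ n (λ i j → f (suc i) * g j) (λ i j → f i * g (suc j)) ⟩
  binomSum n (λ i j → f (suc i) * g j) + binomSum n (λ i j → f i * g (suc j))
    ≡⟨ sym (cong₂ _+_ (binomConv≡binomSum n (f ∘ suc) g) (binomConv≡binomSum n f (g ∘ suc))) ⟩
  binomConv n (f ∘ suc) g + binomConv n f (g ∘ suc) ∎

binomConv-cong : ∀ n {f f′ g g′ : ℕ → ℤ} → (∀ k → f k ≡ f′ k) → (∀ k → g k ≡ g′ k) →
                 binomConv n f g ≡ binomConv n f′ g′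
binomConv-cong n f≗f′ g≗g′ =
  sumMap-cong (λ i → cong₂ (λ a b → + (n C i) * a * b) (f≗f′ i) (g≗g′ (n ∸ i))) (upTo (suc n))

binomConv-+ˡ : ∀ n f f′ g → binomConv n (λ k → f k + f′ k) g ≡ binomConv n f g + binomConv n f′ g
binomConv-+ˡ n f f′ g = trans (sumMap-cong (λ i → distrib (+ (n C i)) (f i) (f′ i) (g (n ∸ i))) (upTo (suc n)))
  (sumMap-+ (λ i → + (n C i) * f i * g (n ∸ i)) (λ i → + (n C i) * f′ i * g (n ∸ i)) (upTo (suc n)))
  where
  distrib : ∀ c a a′ b → c * (a + a′) * b ≡ c * a * b + c * a′ * b
  distrib = solve-∀

binomConv-+ʳ : ∀ n f g g′ → binomConv n f (λ k → g k + g′ k) ≡ binomConv n f g + binomConv n f g′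
binomConv-+ʳ n f g g′ = trans (sumMap-cong (λ i → distrib (+ (n C i)) (f i) (g (n ∸ i)) (g′ (n ∸ i))) (upTo (suc n)))
  (sumMap-+ (λ i → + (n C i) * f i * g (n ∸ i)) (λ i → + (n C i) * f i * g′ (n ∸ i)) (upTo (suc n)))
  where
  distrib : ∀ c a b b′ → c * a * (b + b′) ≡ c * a * b + c * a * b′
  distrib = solve-∀

binomConv-*ˡ : ∀ n c f g → binomConv n (λ k → c * f k) g ≡ c * binomConv n f g
binomConv-*ˡ n c f g = trans (sumMap-cong (λ i → reassoc (+ (n C i)) c (f i) (g (n ∸ i))) (upTo (suc n)))
  (sumMap-* c (λ i → + (n C i) * f i * g (n ∸ i)) (upTo (suc n)))
  where
  reassoc : ∀ b c a d → b * (c * a) * d ≡ c * (b * a * d)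
  reassoc = solve-∀

binomConv-*ʳ : ∀ n c f g → binomConv n f (λ k → c * g k) ≡ c * binomConv n f g
binomConv-*ʳ n c f g = trans (sumMap-cong (λ i → reassoc (+ (n C i)) c (f i) (g (n ∸ i))) (upTo (suc n)))
  (sumMap-* c (λ i → + (n C i) * f i * g (n ∸ i)) (upTo (suc n)))
  where
  reassoc : ∀ b c a d → b * a * (c * d) ≡ c * (b * a * d)
  reassoc = solve-∀

binomConv-comm : ∀ n f g → binomConv n f g ≡ binomConv n g f
binomConv-comm zero    f g = commute (f 0) (g 0)
  where
  commute : ∀ a b → + 1 * a * b + + 0 ≡ + 1 * b * a + + 0
  commute = solve-∀
binomConv-comm (suc n) f g = begin
  binomConv (suc n) f g
    ≡⟨ binomConv-suc n f g ⟩
  binomConv n (f ∘ suc) g + binomConv n f (g ∘ suc)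
    ≡⟨ cong₂ _+_ (binomConv-comm n (f ∘ suc) g) (binomConv-comm n f (g ∘ suc)) ⟩
  binomConv n g (f ∘ suc) + binomConv n (g ∘ suc) f
    ≡⟨ ℤ.+-comm (binomConv n g (f ∘ suc)) _ ⟩
  binomConv n (g ∘ suc) f + binomConv n g (f ∘ suc)
    ≡⟨ sym (binomConv-suc n g f) ⟩
  binomConv (suc n) g f ∎

binomConv-assoc : ∀ n f g h → binomConv n (λ m → binomConv m f g) h ≡ binomConv n f (λ m → binomConv m g h)
binomConv-assoc zero    f g h = reassoc (f 0) (g 0) (h 0)
  where
  reassoc : ∀ a b c → + 1 * (+ 1 * a * b + + 0) * c + + 0 ≡ + 1 * a * (+ 1 * b * c + + 0) + + 0
  reassoc = solve-∀
binomConv-assoc (suc n) f g h = begin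
  binomConv (suc n) fg h
    ≡⟨ binomConv-suc n fg h ⟩
  binomConv n (fg ∘ suc) h + binomConv n fg (h ∘ suc)
    ≡⟨ cong (_+ binomConv n fg (h ∘ suc)) (binomConv-cong n {g = h} (λ m → binomConv-suc m f g) (λ _ → refl)) ⟩
  binomConv n (λ m → f′g m + fg′ m) h + binomConv n fg (h ∘ suc)
    ≡⟨ cong (_+ binomConv n fg (h ∘ suc)) (binomConv-+ˡ n f′g fg′ h) ⟩
  binomConv n f′g h + binomConv n fg′ h + binomConv n fg (h ∘ suc)
    ≡⟨ cong₂ _+_ (cong₂ _+_ (binomConv-assoc n (f ∘ suc) g h) (binomConv-assoc n f (g ∘ suc) h))
                 (binomConv-assoc n f g (h ∘ suc)) ⟩
  binomConv n (f ∘ suc) gh + binomConv n f g′h + binomConv n f gh′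
    ≡⟨ ℤ.+-assoc (binomConv n (f ∘ suc) gh) _ _ ⟩
  binomConv n (f ∘ suc) gh + (binomConv n f g′h + binomConv n f gh′)
    ≡⟨ cong (_+_ (binomConv n (f ∘ suc) gh)) (sym (binomConv-+ʳ n f g′h gh′)) ⟩
  binomConv n (f ∘ suc) gh + binomConv n f (λ m → g′h m + gh′ m)
    ≡⟨ cong (_+_ (binomConv n (f ∘ suc) gh))
            (binomConv-cong n {f = f} (λ _ → refl) (λ m → sym (binomConv-suc m g h))) ⟩
  binomConv n (f ∘ suc) gh + binomConv n f (gh ∘ suc)
    ≡⟨ sym (binomConv-suc n f gh) ⟩
  binomConv (suc n) f gh ∎
  where
  fg f′g fg′ gh g′h gh′ : ℕ → ℤ
  fg  m = binomConv m f g
  f′g m = binomConv m (f ∘ suc) g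
  fg′ m = binomConv m f (g ∘ suc)
  gh  m = binomConv m g h
  g′h m = binomConv m (g ∘ suc) h
  gh′ m = binomConv m g (h ∘ suc)

binomial-theorem : ∀ n a b → binomConv n (a ^_) (b ^_) ≡ (a + b) ^ n
binomial-theorem zero    a b = refl
binomial-theorem (suc n) a b = begin
  binomConv (suc n) (a ^_) (b ^_)
    ≡⟨ binomConv-suc n (a ^_) (b ^_) ⟩
  binomConv n (λ k → a * a ^ k) (b ^_) + binomConv n (a ^_) (λ k → b * b ^ k)
    ≡⟨ cong₂ _+_ (binomConv-*ˡ n a (a ^_) (b ^_)) (binomConv-*ʳ n b (a ^_) (b ^_)) ⟩
  a * binomConv n (a ^_) (b ^_) + b * binomConv n (a ^_) (b ^_)
    ≡⟨ cong (λ c → a * c + b * c) (binomial-theorem n a b) ⟩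
  a * (a + b) ^ n + b * (a + b) ^ n
    ≡⟨ sym (ℤ.*-distribʳ-+ ((a + b) ^ n) a b) ⟩
  (a + b) ^ suc n ∎

binomConv-identityˡ : ∀ n g → binomConv n (_^_ (+ 0)) g ≡ g n
binomConv-identityˡ zero    g = unit (g 0)
  where
  unit : ∀ a → + 1 * + 1 * a + + 0 ≡ a
  unit = solve-∀
binomConv-identityˡ (suc n) g = begin
  binomConv (suc n) (_^_ (+ 0)) g
    ≡⟨ binomConv-suc n (_^_ (+ 0)) g ⟩
  binomConv n (λ k → + 0 * (+ 0) ^ k) g + binomConv n (_^_ (+ 0)) (g ∘ suc)
    ≡⟨ cong₂ _+_ (binomConv-*ˡ n (+ 0) (_^_ (+ 0)) g) (binomConv-identityˡ n (g ∘ suc)) ⟩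
  + 0 * binomConv n (_^_ (+ 0)) g + g (suc n)
    ≡⟨ ℤ.+-identityˡ (g (suc n)) ⟩
  g (suc n) ∎

-- Weights

Weight : Set
Weight = ℕ → ℕ → ℕ → ℤ

Triple : Set
Triple = ℕ × ℕ × ℕ

shift : Triple → Weight → Weight
shift (β , δ , σ) H p q r = H (β ℕ.+ p) (δ ℕ.+ q) (σ ℕ.+ r)

shift-comm : ∀ s t H p q r → shift s (shift t H) p q r ≡ shift t (shift s H) p q r
shift-comm (α , β , γ) (α′ , β′ , γ′) H p q r
  rewrite ℕ+.x∙yz≈y∙xz α α′ p | ℕ+.x∙yz≈y∙xz β β′ q | ℕ+.x∙yz≈y∙xz γ γ′ r = refl

-- Transpose of D: each of the p + q + r items is traded for one of type (1 , 1 , 0).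
-- At r = 0 the junk value pred 0 is multiplied by 0.
∂ : Weight → Weight
∂ H p q r = + p * H p (suc q) r + + q * H (suc p) q r + + r * H (suc p) (suc q) (pred r)

data Unit : Triple → Set where
  e₁ : Unit (1 , 0 , 0)
  e₂ : Unit (0 , 1 , 0)
  e₃ : Unit (0 , 0 , 1)

∂-shift : ∀ {t} → Unit t → ∀ H p q r → shift t (∂ H) p q r ≡ H (suc p) (suc q) r + ∂ (shift t H) p q r
∂-shift e₁ H p q r =
  peel (+ p) (+ q) (+ r) (H (suc p) (suc q) r) (H (suc (suc p)) q r) (H (suc (suc p)) (suc q) (pred r))
  where
  peel : ∀ P Q R a b c → (+ 1 + P) * a + Q * b + R * c ≡ a + (P * a + Q * b + R * c)
  peel = solve-∀
∂-shift e₂ H p q r =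
  peel (+ p) (+ q) (+ r) (H p (suc (suc q)) r) (H (suc p) (suc q) r) (H (suc p) (suc (suc q)) (pred r))
  where
  peel : ∀ P Q R a b c → P * a + (+ 1 + Q) * b + R * c ≡ b + (P * a + Q * b + R * c)
  peel = solve-∀
∂-shift e₃ H p q zero =
  peel (+ p) (+ q) (H p (suc q) 1) (H (suc p) q 1) (H (suc p) (suc q) 0) (H (suc p) (suc q) 1)
  where
  peel : ∀ P Q a b c d → P * a + Q * b + + 1 * c ≡ c + (P * a + Q * b + + 0 * d)
  peel = solve-∀
∂-shift e₃ H p q (suc r) =
  peel (+ p) (+ q) (+ r) (H p (suc q) (suc (suc r))) (H (suc p) q (suc (suc r))) (H (suc p) (suc q) (suc r))
  where
  peel : ∀ P Q R a b c → P * a + Q * b + (+ 1 + (+ 1 + R)) * c ≡ c + (P * a + Q * b + (+ 1 + R) * c)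
  peel = solve-∀

-- Transpose of inserting a new largest entry in all possible ways: one insertion adds an item
-- of type u, each of the others trades an item for one of type (1 , 1 , 0).
extend : Triple → Weight → Weight
extend u H p q r = shift u H p q r + ∂ H p q r

extend-shift : ∀ {t} → Unit t → ∀ u H p q r →
               shift t (extend u H) p q r ≡ H (suc p) (suc q) r + extend u (shift t H) p q r
extend-shift {t} unit u H p q r = begin
  shift t (shift u H) p q r + shift t (∂ H) p q r
    ≡⟨ cong₂ _+_ (shift-comm t u H p q r) (∂-shift unit H p q r) ⟩
  shift u (shift t H) p q r + (H (suc p) (suc q) r + ∂ (shift t H) p q r)
    ≡⟨ x∙yz≈y∙xz (shift u (shift t H) p q r) (H (suc p) (suc q) r) _ ⟩
  H (suc p) (suc q) r + extend u (shift t H) p q r ∎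

-- Permutations as lists

<ᵇ-true : ∀ {m n} → m < n → (m <ᵇ n) ≡ true
<ᵇ-true {m} {n} = dec-true (m <? n)

<ᵇ-false : ∀ {m n} → ¬ m < n → (m <ᵇ n) ≡ false
<ᵇ-false {m} {n} = dec-false (m <? n)

≡ᵇ-refl : ∀ m → (m ≡ᵇ m) ≡ true
≡ᵇ-refl m = dec-true (m ≟ m) refl

≡ᵇ-false : ∀ {m n} → m ≢ n → (m ≡ᵇ n) ≡ false
≡ᵇ-false {m} {n} = dec-false (m ≟ n)

insertAll-↭ : ∀ a π {τ} → τ ∈ insertAll a π → τ ↭ a ∷ π
insertAll-↭ a []       (here refl) = ↭-refl
insertAll-↭ a (b ∷ bs) (here refl) = ↭-refl
insertAll-↭ a (b ∷ bs) (there τ∈) with τ , τ∈′ , refl ← ∈-map⁻ (b ∷_) τ∈ =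
  ↭-trans (prep b (insertAll-↭ a bs τ∈′)) (swap b a ↭-refl)

insertAll-∈ : ∀ a α β → α ++ a ∷ β ∈ insertAll a (α ++ β)
insertAll-∈ a []      []      = here refl
insertAll-∈ a []      (b ∷ β) = here refl
insertAll-∈ a (c ∷ α) β       = there (∈-map⁺ (c ∷_) (insertAll-∈ a α β))

perms-↭ : ∀ n {π} → π ∈ perms n → π ↭ applyDownFrom suc n
perms-↭ zero    (here refl) = ↭-refl
perms-↭ (suc n) π∈ with σ , σ∈ , π∈σ ← find (∈-concatMap⁻ (insertAll (suc n)) π∈) =
  ↭-trans (insertAll-↭ (suc n) σ π∈σ) (prep (suc n) (perms-↭ n σ∈))

perms-complete : ∀ n {π} → π ↭ applyDownFrom suc n → π ∈ perms n
perms-complete zero    p rewrite ↭.↭-empty-inv p = here refl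
perms-complete (suc n) p with α , β , refl ← ∈-∃++ (↭.∈-resp-↭ (↭-sym p) (here refl)) =
  ∈-concatMap⁺ (insertAll (suc n)) (lose (perms-complete n α++β↭) (insertAll-∈ (suc n) α β))
  where
  α++β↭ : α ++ β ↭ applyDownFrom suc n
  α++β↭ = ↭.drop-∷ (↭-trans (↭-sym (↭.shift (suc n) α β)) p)

applyDownFrom-< : ∀ n → All (_< suc n) (applyDownFrom suc n)
applyDownFrom-< zero    = []
applyDownFrom-< (suc n) = ℕ.≤-refl ∷ All.map ℕ.m<n⇒m<1+n (applyDownFrom-< n)

applyDownFrom-Unique : ∀ n → Unique (applyDownFrom suc n)
applyDownFrom-Unique zero    = []
applyDownFrom-Unique (suc n) = All.map (λ m<1+n → ℕ.<⇒≢ m<1+n ∘ sym) (applyDownFrom-< n) ∷ applyDownFrom-Unique n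

∈perms⇒< : ∀ n {π} → π ∈ perms n → All (_< suc n) π
∈perms⇒< n π∈ = ↭.All-resp-↭ (↭-sym (perms-↭ n π∈)) (applyDownFrom-< n)

∈perms⇒Unique : ∀ n {π} → π ∈ perms n → Unique π
∈perms⇒Unique n π∈ = ↭ₛ.Unique-resp-↭ (setoid ℕ) (↭⇒↭ₛ (↭-sym (perms-↭ n π∈))) (applyDownFrom-Unique n)

∈perms⇒length : ∀ n {π} → π ∈ perms n → length π ≡ n
∈perms⇒length n π∈ = trans (↭.↭-length (perms-↭ n π∈)) (List.length-applyDownFrom suc n)

data UniqueMax (n : ℕ) : List ℕ → Set where
  here  : ∀ {bs} → All (_< n) bs → UniqueMax n (n ∷ bs)
  there : ∀ {b bs} → b < n → UniqueMax n bs → UniqueMax n (b ∷ bs)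

Unique⇒UniqueMax : ∀ {n π} → Unique π → All (_≤ n) π → n ∈ π → UniqueMax n π
Unique⇒UniqueMax (n∉ ∷ _) (_ ∷ ≤n) (here refl) =
  here (All.zipWith (λ (b≤n , n≢b) → ℕ.≤∧≢⇒< b≤n (n≢b ∘ sym)) (≤n , n∉))
Unique⇒UniqueMax (b∉ ∷ u) (b≤n ∷ ≤n) (there n∈) =
  there (ℕ.≤∧≢⇒< b≤n (All.lookup b∉ n∈)) (Unique⇒UniqueMax u ≤n n∈)

UniqueMax-head : ∀ {n b bs} → UniqueMax n (b ∷ bs) → b < suc n
UniqueMax-head (here _)      = ℕ.n<1+n _
UniqueMax-head (there b<n _) = ℕ.m<n⇒m<1+n b<n

∈perms⇒UniqueMax : ∀ n {π} → π ∈ perms (suc n) → UniqueMax (suc n) π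
∈perms⇒UniqueMax n π∈ = Unique⇒UniqueMax (∈perms⇒Unique (suc n) π∈) (All.map ℕ.≤-pred (∈perms⇒< (suc n) π∈))
  (↭.∈-resp-↭ (↭-sym (perms-↭ (suc n) π∈)) (here refl))

-- The j-th list puts a at position j and moves π(j) to the end, i.e. in cycle notation
-- a is inserted after j; the last list adds the fixed point a.
cycleInsertAll : ℕ → List ℕ → List (List ℕ)
cycleInsertAll a []       = (a ∷ []) ∷ []
cycleInsertAll a (b ∷ bs) = (a ∷ (bs ∷ʳ b)) ∷ map (b ∷_) (cycleInsertAll a bs)

cyclePerms : ℕ → List (List ℕ)
cyclePerms zero    = [] ∷ []
cyclePerms (suc n) = concatMap (cycleInsertAll (suc n)) (cyclePerms n)

cycleInsertAll-↭ : ∀ a π {τ} → τ ∈ cycleInsertAll a π → τ ↭ a ∷ π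
cycleInsertAll-↭ a []       (here refl) = ↭-refl
cycleInsertAll-↭ a (b ∷ bs) (here refl) = prep a (↭.++-comm bs (b ∷ []))
cycleInsertAll-↭ a (b ∷ bs) (there τ∈) with τ , τ∈′ , refl ← ∈-map⁻ (b ∷_) τ∈ =
  ↭-trans (prep b (cycleInsertAll-↭ a bs τ∈′)) (swap b a ↭-refl)

cyclePerms-↭ : ∀ n {π} → π ∈ cyclePerms n → π ↭ applyDownFrom suc n
cyclePerms-↭ zero    (here refl) = ↭-refl
cyclePerms-↭ (suc n) π∈ with σ , σ∈ , π∈σ ← find (∈-concatMap⁻ (cycleInsertAll (suc n)) π∈) =
  ↭-trans (cycleInsertAll-↭ (suc n) σ π∈σ) (prep (suc n) (cyclePerms-↭ n σ∈))

∈cyclePerms⇒< : ∀ n {π} → π ∈ cyclePerms n → All (_< suc n) π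
∈cyclePerms⇒< n π∈ = ↭.All-resp-↭ (↭-sym (cyclePerms-↭ n π∈)) (applyDownFrom-< n)

∈cyclePerms⇒length : ∀ n {π} → π ∈ cyclePerms n → length π ≡ n
∈cyclePerms⇒length n π∈ = trans (↭.↭-length (cyclePerms-↭ n π∈)) (List.length-applyDownFrom suc n)

lastToFront : List ℕ → List ℕ
lastToFront xs with reverse xs
... | []     = []
... | y ∷ ys = y ∷ reverse ys

lastToFront-∷ʳ : ∀ xs x → lastToFront (xs ∷ʳ x) ≡ x ∷ xs
lastToFront-∷ʳ xs x rewrite List.reverse-++ xs (x ∷ []) | List.reverse-involutive xs = refl

uninsert : ℕ → List ℕ → List ℕ
uninsert a []      = []
uninsert a (c ∷ τ) = if c ≡ᵇ a then lastToFront τ else c ∷ uninsert a τ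

uninsert-cycleInsertAll : ∀ {a} π {τ} → All (_< a) π → τ ∈ cycleInsertAll a π → uninsert a τ ≡ π
uninsert-cycleInsertAll {a} []       _          (here refl) rewrite ≡ᵇ-refl a = refl
uninsert-cycleInsertAll {a} (b ∷ bs) _          (here refl) rewrite ≡ᵇ-refl a = lastToFront-∷ʳ bs b
uninsert-cycleInsertAll {a} (b ∷ bs) (b<a ∷ <a) (there τ∈) with τ , τ∈′ , refl ← ∈-map⁻ (b ∷_) τ∈
  rewrite ≡ᵇ-false (ℕ.<⇒≢ b<a) = cong (b ∷_) (uninsert-cycleInsertAll bs <a τ∈′)

cycleInsertAll-Unique : ∀ {a} π → All (_< a) π → Unique (cycleInsertAll a π)
cycleInsertAll-Unique []       []         = [] ∷ []
cycleInsertAll-Unique (b ∷ bs) (b<a ∷ <a) =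
  AllProps.map⁺ (All.tabulate (λ _ → ℕ.<⇒≢ b<a ∘ sym ∘ List.∷-injectiveˡ))
  ∷ Unique.map⁺ List.∷-injectiveʳ (cycleInsertAll-Unique bs <a)

Unique-concatMap : ∀ (g : A → List B) (g⁻¹ : B → A) {xs} → Unique xs → (∀ {x} → x ∈ xs → Unique (g x)) →
                   (∀ {x y} → x ∈ xs → y ∈ g x → g⁻¹ y ≡ x) → Unique (concatMap g xs)
Unique-concatMap g g⁻¹ {[]}     []       _        _       = []
Unique-concatMap g g⁻¹ {x ∷ xs} (x∉ ∷ u) unique-g inverse =
  Unique.++⁺ (unique-g (here refl)) (Unique-concatMap g g⁻¹ u (unique-g ∘ there) (inverse ∘ there)) disjoint
  where
  disjoint : ∀ {y} → ¬ (y ∈ g x × y ∈ concatMap g xs)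
  disjoint (y∈ , y∈′) with x′ , x′∈ , y∈″ ← find (∈-concatMap⁻ g y∈′) =
    All.lookup x∉ x′∈ (trans (sym (inverse (here refl) y∈)) (inverse (there x′∈) y∈″))

cyclePerms-Unique : ∀ n → Unique (cyclePerms n)
cyclePerms-Unique zero    = [] ∷ []
cyclePerms-Unique (suc n) = Unique-concatMap (cycleInsertAll (suc n)) (uninsert (suc n)) (cyclePerms-Unique n)
  (λ π∈ → cycleInsertAll-Unique _ (∈cyclePerms⇒< n π∈))
  (λ π∈ → uninsert-cycleInsertAll _ (∈cyclePerms⇒< n π∈))

length-concatMap : ∀ (g : A → List B) k xs → (∀ {x} → x ∈ xs → length (g x) ≡ k) →
                   length (concatMap g xs) ≡ k ℕ.* length xs
length-concatMap g k []       _       = sym (ℕ.*-zeroʳ k)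
length-concatMap g k (x ∷ xs) length-g = begin
  length (g x ++ concatMap g xs)
    ≡⟨ List.length-++ (g x) ⟩
  length (g x) ℕ.+ length (concatMap g xs)
    ≡⟨ cong₂ ℕ._+_ (length-g (here refl)) (length-concatMap g k xs (length-g ∘ there)) ⟩
  k ℕ.+ k ℕ.* length xs
    ≡⟨ sym (ℕ.*-suc k (length xs)) ⟩
  k ℕ.* suc (length xs) ∎

length-insertAll : ∀ a π → length (insertAll a π) ≡ suc (length π)
length-insertAll a []       = refl
length-insertAll a (b ∷ bs) = cong suc (trans (List.length-map (b ∷_) (insertAll a bs)) (length-insertAll a bs))

length-cycleInsertAll : ∀ a π → length (cycleInsertAll a π) ≡ suc (length π)
length-cycleInsertAll a []       = refl
length-cycleInsertAll a (b ∷ bs) =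
  cong suc (trans (List.length-map (b ∷_) (cycleInsertAll a bs)) (length-cycleInsertAll a bs))

length-cyclePerms : ∀ n → length (cyclePerms n) ≡ length (perms n)
length-cyclePerms zero    = refl
length-cyclePerms (suc n) = begin
  length (cyclePerms (suc n))
    ≡⟨ length-concatMap (cycleInsertAll (suc n)) (suc n) (cyclePerms n) cycle-length ⟩
  suc n ℕ.* length (cyclePerms n)
    ≡⟨ cong (suc n ℕ.*_) (length-cyclePerms n) ⟩
  suc n ℕ.* length (perms n)
    ≡⟨ sym (length-concatMap (insertAll (suc n)) (suc n) (perms n) insert-length) ⟩
  length (perms (suc n)) ∎
  where
  cycle-length : ∀ {π} → π ∈ cyclePerms n → length (cycleInsertAll (suc n) π) ≡ suc n
  cycle-length {π} π∈ = trans (length-cycleInsertAll (suc n) π) (cong suc (∈cyclePerms⇒length n π∈))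
  insert-length : ∀ {π} → π ∈ perms n → length (insertAll (suc n) π) ≡ suc n
  insert-length {π} π∈ = trans (length-insertAll (suc n) π) (cong suc (∈perms⇒length n π∈))

Unique∧⊆∧length≤⇒↭ : ∀ (xs ys : List A) → Unique xs → (∀ {z} → z ∈ xs → z ∈ ys) →
                     length ys ℕ.≤ length xs → xs ↭ ys
Unique∧⊆∧length≤⇒↭ []       []       _        _  _ = ↭-refl
Unique∧⊆∧length≤⇒↭ []       (_ ∷ _)  _        _  ()
Unique∧⊆∧length≤⇒↭ (x ∷ xs) ys       (x∉ ∷ u) xs⊆ys ys≤xs with α , β , refl ← ∈-∃++ (xs⊆ys (here refl)) =
  ↭-trans (prep x (Unique∧⊆∧length≤⇒↭ xs (α ++ β) u xs⊆α++β α++β≤xs)) (↭-sym (↭.shift x α β))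
  where
  xs⊆α++β : ∀ {z} → z ∈ xs → z ∈ α ++ β
  xs⊆α++β z∈ with ↭.∈-resp-↭ (↭.shift x α β) (xs⊆ys (there z∈))
  ... | here z≡x   = ⊥-elim (All.lookup x∉ z∈ (sym z≡x))
  ... | there z∈′  = z∈′
  α++β≤xs : length (α ++ β) ℕ.≤ length xs
  α++β≤xs = ℕ.≤-pred (subst (ℕ._≤ suc (length xs)) (↭.↭-length (↭.shift x α β)) ys≤xs)

cyclePerms↭perms : ∀ n → cyclePerms n ↭ perms n
cyclePerms↭perms n = Unique∧⊆∧length≤⇒↭ (cyclePerms n) (perms n) (cyclePerms-Unique n)
  (perms-complete n ∘ cyclePerms-↭ n) (ℕ.≤-reflexive (sym (length-cyclePerms n)))

-- Recurrences

evalA : Weight → List ℕ → ℤ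
evalA H π = H (basc π) (des π) (suc' π)

evalC : Weight → ℕ → List ℕ → ℤ
evalC H k π = H (countPos (λ a i → i <ᵇ a) k π) (countPos (λ a i → a <ᵇ i) k π) (countPos (λ a i → a ≡ᵇ i) k π)

-- evalA H (b ∷ c ∷ τ) reduces to evalA (shift (adjacentType b c) H) (c ∷ τ).
adjacentType : ℕ → ℕ → Triple
adjacentType b c = b2n (suc b <ᵇ c) , b2n (c <ᵇ b) , b2n (c ≡ᵇ suc b)

ascentType : ∀ {b c} → suc b < c → adjacentType b c ≡ (1 , 0 , 0)
ascentType {b} {c} b+1<c
  rewrite <ᵇ-true b+1<c | <ᵇ-false {c} {b} (ℕ.<-asym (ℕ.<-trans (ℕ.n<1+n b) b+1<c))
        | ≡ᵇ-false (ℕ.<⇒≢ b+1<c ∘ sym) = refl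

descentType : ∀ {b c} → c < b → adjacentType b c ≡ (0 , 1 , 0)
descentType {b} {c} c<b
  rewrite <ᵇ-false {suc b} {c} (ℕ.<-asym (ℕ.<-trans c<b (ℕ.n<1+n b)))
        | <ᵇ-true c<b | ≡ᵇ-false (ℕ.<⇒≢ (ℕ.m<n⇒m<1+n c<b)) = refl

successionType : ∀ b → adjacentType b (suc b) ≡ (0 , 0 , 1)
successionType b
  rewrite <ᵇ-false {suc b} {suc b} (ℕ.<-irrefl refl) | <ᵇ-false {suc b} {b} (ℕ.<-asym (ℕ.n<1+n b))
        | ≡ᵇ-refl (suc b) = refl

adjacentUnit : ∀ b c → b ≢ c → Unit (adjacentType b c)
adjacentUnit b c b≢c with ℕ.<-cmp b c
... | tri≈ _ b≡c _ = ⊥-elim (b≢c b≡c)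
... | tri> _ _ c<b = subst Unit (sym (descentType c<b)) e₂
... | tri< b<c _ _ with c ≟ suc b
...   | yes refl     = subst Unit (sym (successionType b)) e₃
...   | no c≢1+b     = subst Unit (sym (ascentType (ℕ.≤∧≢⇒< b<c (c≢1+b ∘ sym)))) e₁

-- evalC H k (b ∷ τ) reduces to evalC (shift (positionType k b) H) (suc k) τ.
positionType : ℕ → ℕ → Triple
positionType k b = b2n (k <ᵇ b) , b2n (b <ᵇ k) , b2n (b ≡ᵇ k)

excedanceType : ∀ {k b} → k < b → positionType k b ≡ (1 , 0 , 0)
excedanceType k<b rewrite <ᵇ-true k<b | <ᵇ-false (ℕ.<-asym k<b) | ≡ᵇ-false (ℕ.<⇒≢ k<b ∘ sym) = refl

dropType : ∀ {k b} → b < k → positionType k b ≡ (0 , 1 , 0)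
dropType b<k rewrite <ᵇ-false (ℕ.<-asym b<k) | <ᵇ-true b<k | ≡ᵇ-false (ℕ.<⇒≢ b<k) = refl

fixedPointType : ∀ k → positionType k k ≡ (0 , 0 , 1)
fixedPointType k rewrite <ᵇ-false (ℕ.<-irrefl {k} refl) | ≡ᵇ-refl k = refl

positionUnit : ∀ k b → Unit (positionType k b)
positionUnit k b with ℕ.<-cmp k b
... | tri< k<b _ _  = subst Unit (sym (excedanceType k<b)) e₁
... | tri≈ _ refl _ = subst Unit (sym (fixedPointType k)) e₃
... | tri> _ _ b<k  = subst Unit (sym (dropType b<k)) e₂

ΣA : ℕ → Weight → ℤ
ΣA n H = sumMap (evalA H) (perms n)

-- Transpose of y + s + D.
τA : Weight → Weight
τA H p q r = H p (suc q) r + extend (0 , 0 , 1) H p q r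

evalA-ascent : ∀ H {b n} τ → b < n → evalA H (b ∷ suc n ∷ τ) ≡ evalA (shift (1 , 0 , 0) H) (suc n ∷ τ)
evalA-ascent H {n = n} τ b<n = cong (λ t → evalA (shift t H) (suc n ∷ τ)) (ascentType (s≤s b<n))

evalA-descent : ∀ H {b c} τ → c < b → evalA H (b ∷ c ∷ τ) ≡ evalA (shift (0 , 1 , 0) H) (c ∷ τ)
evalA-descent H {c = c} τ c<b = cong (λ t → evalA (shift t H) (c ∷ τ)) (descentType c<b)

evalA-succession : ∀ H b τ → evalA H (b ∷ suc b ∷ τ) ≡ evalA (shift (0 , 0 , 1) H) (suc b ∷ τ)
evalA-succession H b τ = cong (λ t → evalA (shift t H) (suc b ∷ τ)) (successionType b)

insertAll-evalA-step : ∀ u H {n b c} cs → b < n → c < suc n → b ≢ c →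
  sumMap (λ τ → evalA (shift (adjacentType b c) H) (c ∷ τ)) (insertAll (suc n) cs)
    ≡ evalA (extend u (shift (adjacentType b c) H)) (c ∷ cs) →
  sumMap (λ τ → evalA H (b ∷ τ)) (insertAll (suc n) (c ∷ cs)) ≡ evalA (extend u H) (b ∷ c ∷ cs)
insertAll-evalA-step u H {n} {b} {c} cs b<n c<1+n b≢c rest = begin
  evalA H (b ∷ suc n ∷ c ∷ cs) + sumMap (λ τ → evalA H (b ∷ τ)) (map (c ∷_) (insertAll (suc n) cs))
    ≡⟨ cong₂ _+_ (trans (evalA-ascent H (c ∷ cs) b<n) (evalA-descent (shift (1 , 0 , 0) H) cs c<1+n))
                 (sumMap-map (λ τ → evalA H (b ∷ τ)) (c ∷_) (insertAll (suc n) cs)) ⟩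
  H (suc p) (suc q) r + sumMap (λ τ → evalA (shift t H) (c ∷ τ)) (insertAll (suc n) cs)
    ≡⟨ cong (_+_ (H (suc p) (suc q) r)) rest ⟩
  H (suc p) (suc q) r + extend u (shift t H) p q r
    ≡⟨ sym (extend-shift (adjacentUnit b c b≢c) u H p q r) ⟩
  evalA (extend u H) (b ∷ c ∷ cs) ∎
  where
  t : Triple
  t = adjacentType b c
  p q r : ℕ
  p = basc (c ∷ cs)
  q = des (c ∷ cs)
  r = suc' (c ∷ cs)

insertAll-evalA-below : ∀ H {n b} bs → All (_< n) (b ∷ bs) → Unique (b ∷ bs) →
  sumMap (λ τ → evalA H (b ∷ τ)) (insertAll (suc n) bs) ≡ evalA (extend (1 , 0 , 0) H) (b ∷ bs)
insertAll-evalA-below H []       (b<n ∷ []) _ = cong (_+ + 0) (evalA-ascent H [] b<n)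
insertAll-evalA-below H {b = b} (c ∷ cs) (b<n ∷ c<n ∷ <n) ((b≢c ∷ _) ∷ u) =
  insertAll-evalA-step (1 , 0 , 0) H cs b<n (ℕ.m<n⇒m<1+n c<n) b≢c
    (insertAll-evalA-below (shift (adjacentType b c) H) cs (c<n ∷ <n) u)

insertAll-evalA-max : ∀ H {n b} bs → UniqueMax n (b ∷ bs) → Unique (b ∷ bs) →
  sumMap (λ τ → evalA H (b ∷ τ)) (insertAll (suc n) bs) ≡ evalA (extend (0 , 0 , 1) H) (b ∷ bs)
insertAll-evalA-max H {n} []   (here []) _ = cong (_+ + 0) (evalA-succession H n [])
insertAll-evalA-max H {n} (c ∷ cs) (here (c<n ∷ <n)) (_ ∷ u) = begin
  evalA H (n ∷ suc n ∷ c ∷ cs) + sumMap (λ τ → evalA H (n ∷ τ)) (map (c ∷_) (insertAll (suc n) cs))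
    ≡⟨ cong₂ _+_ (trans (evalA-succession H n (c ∷ cs)) (evalA-descent (shift (0 , 0 , 1) H) cs (ℕ.m<n⇒m<1+n c<n)))
                 (trans (sumMap-map (λ τ → evalA H (n ∷ τ)) (c ∷_) (insertAll (suc n) cs))
                        (sumMap-cong (λ τ → evalA-descent H τ c<n) (insertAll (suc n) cs))) ⟩
  H p (suc q) (suc r) + sumMap (λ τ → evalA (shift (0 , 1 , 0) H) (c ∷ τ)) (insertAll (suc n) cs)
    ≡⟨ cong (_+_ (H p (suc q) (suc r))) (insertAll-evalA-below (shift (0 , 1 , 0) H) cs (c<n ∷ <n) u) ⟩
  H p (suc q) (suc r) + (H (suc p) (suc q) r + ∂ (shift (0 , 1 , 0) H) p q r)
    ≡⟨ cong (_+_ (H p (suc q) (suc r))) (sym (∂-shift e₂ H p q r)) ⟩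
  shift (0 , 1 , 0) (extend (0 , 0 , 1) H) p q r
    ≡⟨ sym (evalA-descent (extend (0 , 0 , 1) H) cs c<n) ⟩
  evalA (extend (0 , 0 , 1) H) (n ∷ c ∷ cs) ∎
  where
  p q r : ℕ
  p = basc (c ∷ cs)
  q = des (c ∷ cs)
  r = suc' (c ∷ cs)
insertAll-evalA-max H {b = b} (c ∷ cs) (there b<n max) ((b≢c ∷ _) ∷ u) =
  insertAll-evalA-step (0 , 0 , 1) H cs b<n (UniqueMax-head max) b≢c
    (insertAll-evalA-max (shift (adjacentType b c) H) cs max u)

insertAll-evalA : ∀ H {n π} → UniqueMax n π → Unique π → sumMap (evalA H) (insertAll (suc n) π) ≡ evalA (τA H) π
insertAll-evalA H {π = []}     ()
insertAll-evalA H {n} {b ∷ bs} max u =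
  cong₂ _+_ (evalA-descent H bs (UniqueMax-head max))
            (trans (sumMap-map (evalA H) (b ∷_) (insertAll (suc n) bs)) (insertAll-evalA-max H bs max u))

ΣA-suc : ∀ n H → ΣA (suc (suc n)) H ≡ ΣA (suc n) (τA H)
ΣA-suc n H = trans (sumMap-concatMap (evalA H) (insertAll (suc (suc n))) (perms (suc n)))
  (sumMap-cong-∈ (perms (suc n)) (λ π∈ → insertAll-evalA H (∈perms⇒UniqueMax n π∈) (∈perms⇒Unique (suc n) π∈)))

ΣC : ℕ → Weight → ℤ
ΣC n H = sumMap (evalC H 1) (perms n)

-- Transpose of s + D.
τC : Weight → Weight
τC = extend (0 , 0 , 1)

ΣC-cong : ∀ n {H G : Weight} → (∀ p q r → H p q r ≡ G p q r) → ΣC n H ≡ ΣC n G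
ΣC-cong n H≗G = sumMap-cong (λ π → H≗G _ _ _) (perms n)

ΣC-+ : ∀ n (H G : Weight) → ΣC n (λ p q r → H p q r + G p q r) ≡ ΣC n H + ΣC n G
ΣC-+ n H G = sumMap-+ (evalC H 1) (evalC G 1) (perms n)

ΣC-* : ∀ n c (H : Weight) → ΣC n (λ p q r → c * H p q r) ≡ c * ΣC n H
ΣC-* n c H = sumMap-* c (evalC H 1) (perms n)

evalC-∷ʳ : ∀ H k xs {v} → v < k ℕ.+ length xs → evalC H k (xs ∷ʳ v) ≡ evalC (shift (0 , 1 , 0) H) k xs
evalC-∷ʳ H k []       {v} v<k = cong (λ t → shift t H 0 0 0) (dropType (subst (v <_) (ℕ.+-identityʳ k) v<k))
evalC-∷ʳ H k (x ∷ xs) {v} v<k =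
  trans (evalC-∷ʳ (shift (positionType k x) H) (suc k) xs (subst (v <_) (ℕ.+-suc k (length xs)) v<k))
        (shift-comm (0 , 1 , 0) (positionType k x) H _ _ _)

-- Positions are counted from k, so a = k + length π is the position the displaced entry moves to.
cycleInsertAll-evalC : ∀ H {a} k π → a ≡ k ℕ.+ length π → All (_< a) π →
                       sumMap (evalC H k) (cycleInsertAll a π) ≡ evalC (τC H) k π
cycleInsertAll-evalC H k [] a≡k+0 [] rewrite trans a≡k+0 (ℕ.+-identityʳ k) =
  cong (λ t → shift t H 0 0 0 + + 0) (fixedPointType k)
cycleInsertAll-evalC H {a} k (b ∷ bs) a≡k+1+bs (b<a ∷ <a) = begin
  evalC H k (a ∷ (bs ∷ʳ b)) + sumMap (evalC H k) (map (b ∷_) (cycleInsertAll a bs))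
    ≡⟨ cong₂ _+_ (trans (cong (λ t → evalC (shift t H) (suc k) (bs ∷ʳ b)) (excedanceType k<a))
                        (evalC-∷ʳ (shift (1 , 0 , 0) H) (suc k) bs (subst (b <_) a≡ b<a)))
                 (sumMap-map (evalC H k) (b ∷_) (cycleInsertAll a bs)) ⟩
  H (suc p) (suc q) r + sumMap (evalC (shift t H) (suc k)) (cycleInsertAll a bs)
    ≡⟨ cong (_+_ (H (suc p) (suc q) r)) (cycleInsertAll-evalC (shift t H) (suc k) bs a≡ <a) ⟩
  H (suc p) (suc q) r + τC (shift t H) p q r
    ≡⟨ sym (extend-shift (positionUnit k b) (0 , 0 , 1) H p q r) ⟩
  evalC (τC H) k (b ∷ bs) ∎
  where
  a≡ : a ≡ suc k ℕ.+ length bs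
  a≡ = trans a≡k+1+bs (ℕ.+-suc k (length bs))
  k<a : k < a
  k<a = subst (k <_) (sym a≡) (s≤s (ℕ.m≤m+n k (length bs)))
  t : Triple
  t = positionType k b
  p q r : ℕ
  p = countPos (λ a i → i <ᵇ a) (suc k) bs
  q = countPos (λ a i → a <ᵇ i) (suc k) bs
  r = countPos (λ a i → a ≡ᵇ i) (suc k) bs

ΣC-suc : ∀ n H → ΣC (suc n) H ≡ ΣC n (τC H)
ΣC-suc n H = begin
  sumMap (evalC H 1) (perms (suc n))
    ≡⟨ sumMap-↭ (evalC H 1) (↭-sym (cyclePerms↭perms (suc n))) ⟩
  sumMap (evalC H 1) (concatMap (cycleInsertAll (suc n)) (cyclePerms n))
    ≡⟨ sumMap-concatMap (evalC H 1) (cycleInsertAll (suc n)) (cyclePerms n) ⟩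
  sumMap (λ π → sumMap (evalC H 1) (cycleInsertAll (suc n) π)) (cyclePerms n)
    ≡⟨ sumMap-cong-∈ (cyclePerms n) (λ {π} π∈ →
         cycleInsertAll-evalC H 1 π (cong suc (sym (∈cyclePerms⇒length n π∈))) (∈cyclePerms⇒< n π∈)) ⟩
  sumMap (evalC (τC H) 1) (cyclePerms n)
    ≡⟨ sumMap-↭ (evalC (τC H) 1) (cyclePerms↭perms n) ⟩
  ΣC n (τC H) ∎

ΣE : ℕ → (ℕ → ℕ → ℤ) → ℤ
ΣE n K = ΣC n (λ e d f → K e (d ℕ.+ f))

ΣD : ℕ → (ℕ → ℕ → ℤ) → ℤ
ΣD n K = ΣA n (λ p q r → K q (suc (p ℕ.+ r)))

-- Transpose of y + xy(∂ₓ + ∂ᵧ), the operator of the recurrence for A_n(x,y).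
τE : (ℕ → ℕ → ℤ) → ℕ → ℕ → ℤ
τE K e r = K e (suc r) + + e * K e (suc r) + + r * K (suc e) r

scaled-suc-pred : ∀ d f (G : ℕ → ℤ) → + f * G (suc d ℕ.+ pred f) ≡ + f * G (d ℕ.+ f)
scaled-suc-pred d zero    G = refl
scaled-suc-pred d (suc f) G = cong (λ m → + suc f * G m) (sym (ℕ.+-suc d f))

ΣE-suc : ∀ n K → ΣE (suc n) K ≡ ΣE n (τE K)
ΣE-suc n K = trans (ΣC-suc n (λ e d f → K e (d ℕ.+ f))) (ΣC-cong n pointwise)
  where
  pointwise : ∀ e d f → τC (λ e d f → K e (d ℕ.+ f)) e d f ≡ τE K e (d ℕ.+ f)
  pointwise e d f = begin
    K e (d ℕ.+ suc f) + (+ e * X + + d * Y + + f * K (suc e) (suc d ℕ.+ pred f))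
      ≡⟨ cong₂ (λ m z → K e m + (+ e * X + + d * Y + z)) (ℕ.+-suc d f) (scaled-suc-pred d f (K (suc e))) ⟩
    X + (+ e * X + + d * Y + + f * Y)
      ≡⟨ collect X (+ e) (+ d) (+ f) Y ⟩
    X + + e * X + (+ d + + f) * Y
      ≡⟨ cong (λ c → X + + e * X + c * Y) (sym (ℤ.pos-+ d f)) ⟩
    τE K e (d ℕ.+ f) ∎
    where
    X Y : ℤ
    X = K e (suc (d ℕ.+ f))
    Y = K (suc e) (d ℕ.+ f)
    collect : ∀ x e d f y → x + (e * x + d * y + f * y) ≡ x + e * x + (d + f) * y
    collect = solve-∀

ΣD-suc : ∀ n K → ΣD (suc (suc n)) K ≡ ΣD (suc n) (τE K)
ΣD-suc n K = trans (ΣA-suc n (λ p q r → K q (suc (p ℕ.+ r))))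
                   (sumMap-cong (λ π → pointwise (basc π) (des π) (suc' π)) (perms (suc n)))
  where
  pointwise : ∀ p q r → τA (λ p q r → K q (suc (p ℕ.+ r))) p q r ≡ τE K q (suc (p ℕ.+ r))
  pointwise p q r = begin
    X + (K q (suc (p ℕ.+ suc r)) + (+ p * X + + q * Y + + r * K (suc q) (suc (suc p ℕ.+ pred r))))
      ≡⟨ cong₂ (λ m z → X + (K q (suc m) + (+ p * X + + q * Y + z)))
               (ℕ.+-suc p r) (scaled-suc-pred p r (K (suc q) ∘ suc)) ⟩
    X + (Y + (+ p * X + + q * Y + + r * X))
      ≡⟨ collect X Y (+ p) (+ q) (+ r) ⟩
    Y + + q * Y + (+ 1 + (+ p + + r)) * X
      ≡⟨ cong (λ c → Y + + q * Y + (+ 1 + c) * X) (sym (ℤ.pos-+ p r)) ⟩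
    τE K q (suc (p ℕ.+ r)) ∎
    where
    X Y : ℤ
    X = K (suc q) (suc (p ℕ.+ r))
    Y = K q (suc (suc (p ℕ.+ r)))
    collect : ∀ x y p q r → x + (y + (p * x + q * y + r * x)) ≡ y + q * y + (+ 1 + (p + r)) * x
    collect = solve-∀

ΣE≡ΣD : ∀ n K → ΣE (suc n) K ≡ ΣD (suc n) K
ΣE≡ΣD zero    K = refl
ΣE≡ΣD (suc n) K = trans (ΣE-suc (suc n) K) (trans (ΣE≡ΣD n (τE K)) (sym (ΣD-suc n K)))

-- The product formula

-- Transpose of A_i(x,y) · C_j(x,y,s).
ΣEC : ℕ → ℕ → Weight → ℤ
ΣEC i j H = ΣE i (λ e r → ΣC j (shift (e , r , 0) H))

τE-ΣC : ∀ j (F : ℕ → ℕ → Weight) e r →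
        τE (λ e r → ΣC j (F e r)) e r ≡ ΣC j (λ a b c → τE (λ e r → F e r a b c) e r)
τE-ΣC j F e r = sym (begin
  ΣC j (λ a b c → F e (suc r) a b c + + e * F e (suc r) a b c + + r * F (suc e) r a b c)
    ≡⟨ ΣC-+ j (λ a b c → F e (suc r) a b c + + e * F e (suc r) a b c) (λ a b c → + r * F (suc e) r a b c) ⟩
  ΣC j (λ a b c → F e (suc r) a b c + + e * F e (suc r) a b c) + ΣC j (λ a b c → + r * F (suc e) r a b c)
    ≡⟨ cong₂ _+_ (trans (ΣC-+ j (F e (suc r)) (λ a b c → + e * F e (suc r) a b c))
                        (cong (_+_ (ΣC j (F e (suc r)))) (ΣC-* j (+ e) (F e (suc r)))))
                 (ΣC-* j (+ r) (F (suc e) r)) ⟩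
  τE (λ e r → ΣC j (F e r)) e r ∎)

-- The Leibniz rule (y + s + D)(x^e y^r g) = ((y + D) x^e y^r) g + x^e y^r ((s + D) g), transposed.
τA-shift : ∀ e r H a b c →
           shift (e , r , 0) (τA H) a b c ≡ τE (λ e r → shift (e , r , 0) H a b c) e r + τC (shift (e , r , 0) H) a b c
τA-shift e r H a b c rewrite ℕ.+-suc e a | ℕ.+-suc r b | ℤ.pos-+ e a | ℤ.pos-+ r b =
  distribute (+ e) (+ a) (+ r) (+ b) (+ c) (H (e ℕ.+ a) (suc (r ℕ.+ b)) c) (H (suc (e ℕ.+ a)) (r ℕ.+ b) c)
             (H (e ℕ.+ a) (r ℕ.+ b) (suc c)) (H (suc (e ℕ.+ a)) (suc (r ℕ.+ b)) (pred c))
  where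
  distribute : ∀ e a r b c x y z w →
               x + (z + ((e + a) * x + (r + b) * y + c * w)) ≡ x + e * x + r * y + (z + (a * x + b * y + c * w))
  distribute = solve-∀

ΣEC-suc : ∀ i j H → ΣEC (suc i) j H + ΣEC i (suc j) H ≡ ΣEC i j (τA H)
ΣEC-suc i j H = begin
  ΣE (suc i) K + ΣE i (λ e r → ΣC (suc j) (shift (e , r , 0) H))
    ≡⟨ cong₂ _+_ (ΣE-suc i K) (ΣC-cong i (λ e d f → ΣC-suc j (shift (e , d ℕ.+ f , 0) H))) ⟩
  ΣE i (τE K) + ΣE i (λ e r → ΣC j (τC (shift (e , r , 0) H)))
    ≡⟨ sym (ΣC-+ i (λ e d f → τE K e (d ℕ.+ f)) (λ e d f → ΣC j (τC (shift (e , d ℕ.+ f , 0) H)))) ⟩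
  ΣE i (λ e r → τE K e r + ΣC j (τC (shift (e , r , 0) H)))
    ≡⟨ ΣC-cong i (λ e d f → leibniz e (d ℕ.+ f)) ⟩
  ΣEC i j (τA H) ∎
  where
  K : ℕ → ℕ → ℤ
  K e r = ΣC j (shift (e , r , 0) H)
  leibniz : ∀ e r → τE K e r + ΣC j (τC (shift (e , r , 0) H)) ≡ ΣC j (shift (e , r , 0) (τA H))
  leibniz e r = begin
    τE K e r + ΣC j (τC (shift (e , r , 0) H))
      ≡⟨ cong (_+ ΣC j (τC (shift (e , r , 0) H))) (τE-ΣC j (λ e r → shift (e , r , 0) H) e r) ⟩
    ΣC j (λ a b c → τE (λ e r → shift (e , r , 0) H a b c) e r) + ΣC j (τC (shift (e , r , 0) H))
      ≡⟨ sym (ΣC-+ j (λ a b c → τE (λ e r → shift (e , r , 0) H a b c) e r) (τC (shift (e , r , 0) H))) ⟩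
    ΣC j (λ a b c → τE (λ e r → shift (e , r , 0) H a b c) e r + τC (shift (e , r , 0) H) a b c)
      ≡⟨ ΣC-cong j (λ a b c → sym (τA-shift e r H a b c)) ⟩
    ΣC j (shift (e , r , 0) (τA H)) ∎

ΣA≡binomSum : ∀ n H → ΣA (suc n) H ≡ binomSum n (λ i j → ΣEC i j H)
ΣA≡binomSum zero    H = pad (H 0 0 0)
  where
  pad : ∀ a → a + + 0 ≡ + 1 * (a + + 0 + + 0) + + 0
  pad = solve-∀
ΣA≡binomSum (suc n) H = begin
  ΣA (suc (suc n)) H
    ≡⟨ ΣA-suc n H ⟩
  ΣA (suc n) (τA H)
    ≡⟨ ΣA≡binomSum n (τA H) ⟩
  binomSum n (λ i j → ΣEC i j (τA H))
    ≡⟨ binomSum-cong n (λ i j → sym (ΣEC-suc i j H)) ⟩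
  binomSum n (λ i j → ΣEC (suc i) j H + ΣEC i (suc j) H)
    ≡⟨ sym (binomSum-suc n (λ i j → ΣEC i j H)) ⟩
  binomSum (suc n) (λ i j → ΣEC i j H) ∎

-- Fixed points

-- Transpose of ∂/∂s; the junk value pred 0 is again multiplied by 0.
∂ₛ : Weight → Weight
∂ₛ H p q r = + r * H p q (pred r)

-- ∂ₛ (s + D) = (s + D) ∂ₛ + 1, as ∂ₛ commutes with D.
τC-∂ₛ : ∀ H p q r → τC (∂ₛ H) p q r ≡ H p q r + ∂ₛ (τC H) p q r
τC-∂ₛ H p q zero    = commutator (+ p) (+ q) (H p q 0)
  where
  commutator : ∀ P Q a → + 1 * a + (P * + 0 + Q * + 0 + + 0) ≡ a + + 0
  commutator = solve-∀
τC-∂ₛ H p q (suc r) =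
  commutator (+ p) (+ q) (+ r) (H p q (suc r)) (H p (suc q) r) (H (suc p) q r) (H (suc p) (suc q) (pred r))
  where
  commutator : ∀ P Q R a b c d →
               (+ 1 + (+ 1 + R)) * a + (P * ((+ 1 + R) * b) + Q * ((+ 1 + R) * c) + (+ 1 + R) * (R * d))
                                 ≡ a + (+ 1 + R) * (a + (P * b + Q * c + R * d))
  commutator = solve-∀

ΣC-∂ₛ : ∀ n H → ΣC (suc n) (∂ₛ H) ≡ + suc n * ΣC n H
ΣC-∂ₛ zero    H = unit (H 0 0 0)
  where
  unit : ∀ a → + 1 * a + + 0 ≡ + 1 * (a + + 0)
  unit = solve-∀
ΣC-∂ₛ (suc n) H = begin
  ΣC (suc (suc n)) (∂ₛ H)
    ≡⟨ ΣC-suc (suc n) (∂ₛ H) ⟩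
  ΣC (suc n) (τC (∂ₛ H))
    ≡⟨ ΣC-cong (suc n) (τC-∂ₛ H) ⟩
  ΣC (suc n) (λ p q r → H p q r + ∂ₛ (τC H) p q r)
    ≡⟨ ΣC-+ (suc n) H (∂ₛ (τC H)) ⟩
  ΣC (suc n) H + ΣC (suc n) (∂ₛ (τC H))
    ≡⟨ cong (_+_ (ΣC (suc n) H)) (ΣC-∂ₛ n (τC H)) ⟩
  ΣC (suc n) H + + suc n * ΣC n (τC H)
    ≡⟨ cong (λ z → ΣC (suc n) H + + suc n * z) (sym (ΣC-suc n H)) ⟩
  ΣC (suc n) H + + suc n * ΣC (suc n) H
    ≡⟨ collect (ΣC (suc n) H) (+ n) ⟩
  + suc (suc n) * ΣC (suc n) H ∎
  where
  collect : ∀ a n → a + (+ 1 + n) * a ≡ (+ 1 + (+ 1 + n)) * a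
  collect = solve-∀

withFixedPoints : ℕ → (ℕ → ℕ → ℤ) → Weight
withFixedPoints k G e d f = if f ≡ᵇ k then G e d else + 0

∂ₛ-withFixedPoints : ∀ k G e d f → ∂ₛ (withFixedPoints k G) e d f ≡ + suc k * withFixedPoints (suc k) G e d f
∂ₛ-withFixedPoints k G e d zero    = sym (ℤ.*-zeroʳ (+ suc k))
∂ₛ-withFixedPoints k G e d (suc f) with f ≟ k
... | yes refl = refl
... | no f≢k rewrite ≡ᵇ-false f≢k = trans (ℤ.*-zeroʳ (+ suc f)) (sym (ℤ.*-zeroʳ (+ suc k)))

ΣC-withFixedPoints : ∀ n k G → ΣC n (withFixedPoints k G) ≡ + (n C k) * ΣC (n ∸ k) (withFixedPoints 0 G)
ΣC-withFixedPoints n       zero    G = sym (ℤ.*-identityˡ _)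
ΣC-withFixedPoints zero    (suc k) G = refl
ΣC-withFixedPoints (suc n) (suc k) G = ℤ.*-cancelˡ-≡ (+ suc k) _ _ (begin
  + suc k * ΣC (suc n) (withFixedPoints (suc k) G)
    ≡⟨ sym (ΣC-* (suc n) (+ suc k) (withFixedPoints (suc k) G)) ⟩
  ΣC (suc n) (λ e d f → + suc k * withFixedPoints (suc k) G e d f)
    ≡⟨ sym (ΣC-cong (suc n) (∂ₛ-withFixedPoints k G)) ⟩
  ΣC (suc n) (∂ₛ (withFixedPoints k G))
    ≡⟨ ΣC-∂ₛ n (withFixedPoints k G) ⟩
  + suc n * ΣC n (withFixedPoints k G)
    ≡⟨ cong (_*_ (+ suc n)) (ΣC-withFixedPoints n k G) ⟩
  + suc n * (+ (n C k) * X)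
    ≡⟨ sym (ℤ.*-assoc (+ suc n) (+ (n C k)) X) ⟩
  + suc n * + (n C k) * X
    ≡⟨ cong (_* X) (sym (ℤ.pos-* (suc n) (n C k))) ⟩
  + (suc n ℕ.* (n C k)) * X
    ≡⟨ cong (λ c → + c * X) (sym ([k+1]*[n+1]C[k+1]≡[n+1]*nCk n k)) ⟩
  + (suc k ℕ.* (suc n C suc k)) * X
    ≡⟨ cong (_* X) (ℤ.pos-* (suc k) (suc n C suc k)) ⟩
  + suc k * + (suc n C suc k) * X
    ≡⟨ ℤ.*-assoc (+ suc k) (+ (suc n C suc k)) X ⟩
  + suc k * (+ (suc n C suc k) * X) ∎)
  where
  X : ℤ
  X = ΣC (n ∸ k) (withFixedPoints 0 G)

countPos-≤ : ∀ p k xs → countPos p k xs ≤ length xs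
countPos-≤ p k []       = z≤n
countPos-≤ p k (a ∷ as) = ℕ.+-mono-≤ (b2n≤1 (p a k)) (countPos-≤ p (suc k) as)
  where
  b2n≤1 : ∀ b → b2n b ≤ 1
  b2n≤1 true  = ℕ.≤-refl
  b2n≤1 false = z≤n

ΣC≡binomSum : ∀ n H → ΣC n H ≡ binomSum n (λ k m → ΣC m (withFixedPoints 0 (λ e d → H e d k)))
ΣC≡binomSum n H = begin
  sumMap (evalC H 1) (perms n)
    ≡⟨ sumMap-cong-∈ (perms n) (λ {π} π∈ → sym (sumTo-δ (H (exc π) (drop π)) (fix≤n π∈))) ⟩
  sumMap (λ π → sumTo (suc n) (λ k → withFixedPoints k (λ e d → H e d k) (exc π) (drop π) (fix π))) (perms n)
    ≡⟨ sumMap-sumTo (λ π k → withFixedPoints k (λ e d → H e d k) (exc π) (drop π) (fix π)) (suc n) (perms n) ⟩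
  sumTo (suc n) (λ k → ΣC n (withFixedPoints k (λ e d → H e d k)))
    ≡⟨ sumTo-cong (suc n) (λ k _ → ΣC-withFixedPoints n k (λ e d → H e d k)) ⟩
  binomSum n (λ k m → ΣC m (withFixedPoints 0 (λ e d → H e d k))) ∎
  where
  fix≤n : ∀ {π} → π ∈ perms n → fix π ≤ n
  fix≤n {π} π∈ = subst (fix π ≤_) (∈perms⇒length n π∈) (countPos-≤ _ 1 π)

-- Evaluation at monomials

-- By definition, A3 n x y s, C3 n x y s, A2 n x y, A1 n x and d2 n x y are ΣA n (monomial x y s),
-- ΣC n (monomial x y s), ΣE n (λ e r → x ^ e * y ^ r), ΣD n (λ e r → x ^ e) and
-- ΣC n (withFixedPoints 0 (λ e d → x ^ e * y ^ d)).
monomial : ℤ → ℤ → ℤ → Weight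
monomial x y s p q r = x ^ p * y ^ q * s ^ r

ΣEC-monomial : ∀ i j x y s → ΣEC i j (monomial x y s) ≡ A2 i x y * C3 j x y s
ΣEC-monomial i j x y s = begin
  ΣE i (λ e r → ΣC j (shift (e , r , 0) (monomial x y s)))
    ≡⟨ ΣC-cong i (λ e d f → factor e (d ℕ.+ f)) ⟩
  ΣE i (λ e r → C3 j x y s * (x ^ e * y ^ r))
    ≡⟨ ΣC-* i (C3 j x y s) (λ e d f → x ^ e * y ^ (d ℕ.+ f)) ⟩
  C3 j x y s * A2 i x y
    ≡⟨ ℤ.*-comm (C3 j x y s) (A2 i x y) ⟩
  A2 i x y * C3 j x y s ∎
  where
  split : ∀ e r a b c → shift (e , r , 0) (monomial x y s) a b c ≡ (x ^ e * y ^ r) * monomial x y s a b c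
  split e r a b c = trans (cong₂ (λ u v → u * v * s ^ c) (ℤ.^-distribˡ-+-* x e a) (ℤ.^-distribˡ-+-* y r b))
                          (regroup (x ^ e) (x ^ a) (y ^ r) (y ^ b) (s ^ c))
    where
    regroup : ∀ p q u v w → p * q * (u * v) * w ≡ (p * u) * (q * v * w)
    regroup = solve-∀
  factor : ∀ e r → ΣC j (shift (e , r , 0) (monomial x y s)) ≡ C3 j x y s * (x ^ e * y ^ r)
  factor e r = trans (ΣC-cong j (split e r))
                     (trans (ΣC-* j (x ^ e * y ^ r) (monomial x y s)) (ℤ.*-comm (x ^ e * y ^ r) _))

A3≡binomConv-A2-C3 : ∀ n x y s → A3 (suc n) x y s ≡ binomConv n (λ i → A2 i x y) (λ j → C3 j x y s)
A3≡binomConv-A2-C3 n x y s = begin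
  ΣA (suc n) (monomial x y s)
    ≡⟨ ΣA≡binomSum n (monomial x y s) ⟩
  binomSum n (λ i j → ΣEC i j (monomial x y s))
    ≡⟨ binomSum-cong n (λ i j → ΣEC-monomial i j x y s) ⟩
  binomSum n (λ i j → A2 i x y * C3 j x y s)
    ≡⟨ sym (binomConv≡binomSum n (λ i → A2 i x y) (λ j → C3 j x y s)) ⟩
  binomConv n (λ i → A2 i x y) (λ j → C3 j x y s) ∎

A2≡C3 : ∀ i x y → A2 i x y ≡ C3 i x y y
A2≡C3 i x y = ΣC-cong i (λ e d f →
  trans (cong (_*_ (x ^ e)) (ℤ.^-distribˡ-+-* y d f)) (sym (ℤ.*-assoc (x ^ e) (y ^ d) (y ^ f))))

C3≡binomConv : ∀ j x y s → C3 j x y s ≡ binomConv j (s ^_) (λ m → d2 m x y)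
C3≡binomConv j x y s = begin
  ΣC j (monomial x y s)
    ≡⟨ ΣC≡binomSum j (monomial x y s) ⟩
  binomSum j (λ k m → ΣC m (withFixedPoints 0 (λ e d → x ^ e * y ^ d * s ^ k)))
    ≡⟨ binomSum-cong j derangements ⟩
  binomSum j (λ k m → s ^ k * d2 m x y)
    ≡⟨ sym (binomConv≡binomSum j (s ^_) (λ m → d2 m x y)) ⟩
  binomConv j (s ^_) (λ m → d2 m x y) ∎
  where
  pointwise : ∀ k e d f → withFixedPoints 0 (λ e d → x ^ e * y ^ d * s ^ k) e d f
                        ≡ s ^ k * withFixedPoints 0 (λ e d → x ^ e * y ^ d) e d f
  pointwise k e d zero    = ℤ.*-comm (x ^ e * y ^ d) (s ^ k)
  pointwise k e d (suc f) = sym (ℤ.*-zeroʳ (s ^ k))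
  derangements : ∀ k m → ΣC m (withFixedPoints 0 (λ e d → x ^ e * y ^ d * s ^ k)) ≡ s ^ k * d2 m x y
  derangements k m = trans (ΣC-cong m (pointwise k)) (ΣC-* m (s ^ k) (withFixedPoints 0 (λ e d → x ^ e * y ^ d)))

A3≡binomConv-d2-d2 : ∀ n x y → A3 (suc n) x y (- y) ≡ binomConv n (λ i → d2 i x y) (λ j → d2 j x y)
A3≡binomConv-d2-d2 n x y = begin
  A3 (suc n) x y (- y)
    ≡⟨ A3≡binomConv-A2-C3 n x y (- y) ⟩
  binomConv n (λ i → A2 i x y) (λ j → C3 j x y (- y))
    ≡⟨ binomConv-cong n (λ i → trans (A2≡C3 i x y) (C3≡binomConv i x y y)) (λ j → C3≡binomConv j x y (- y)) ⟩
  binomConv n (λ i → binomConv i eʸ d) (λ j → binomConv j e⁻ʸ d)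
    ≡⟨ binomConv-cong n {g = λ j → binomConv j e⁻ʸ d} (λ i → binomConv-comm i eʸ d) (λ _ → refl) ⟩
  binomConv n (λ i → binomConv i d eʸ) (λ j → binomConv j e⁻ʸ d)
    ≡⟨ binomConv-assoc n d eʸ (λ j → binomConv j e⁻ʸ d) ⟩
  binomConv n d (λ m → binomConv m eʸ (λ j → binomConv j e⁻ʸ d))
    ≡⟨ binomConv-cong n {f = d} (λ _ → refl) (λ m → sym (binomConv-assoc m eʸ e⁻ʸ d)) ⟩
  binomConv n d (λ m → binomConv m (λ k → binomConv k eʸ e⁻ʸ) d)
    ≡⟨ binomConv-cong n {f = d} (λ _ → refl)
         (λ m → trans (binomConv-cong m {g = d} cancel (λ _ → refl)) (binomConv-identityˡ m d)) ⟩
  binomConv n d d ∎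
  where
  eʸ e⁻ʸ d : ℕ → ℤ
  eʸ k  = y ^ k
  e⁻ʸ k = (- y) ^ k
  d m   = d2 m x y
  cancel : ∀ k → binomConv k eʸ e⁻ʸ ≡ (+ 0) ^ k
  cancel k = trans (binomial-theorem k y (- y)) (cong (_^ k) (ℤ.+-inverseʳ y))

ΣE-pow≡A1 : ∀ i x → ΣE i (λ e r → x ^ e) ≡ A1 i x
ΣE-pow≡A1 zero    x = refl
ΣE-pow≡A1 (suc i) x = ΣE≡ΣD i (λ e r → x ^ e)

A2-at-1 : ∀ i x → A2 i x (+ 1) ≡ A1 i x
A2-at-1 i x = trans (ΣC-cong i (λ e d f → trans (cong (_*_ (x ^ e)) (ℤ.^-zeroˡ (d ℕ.+ f))) (ℤ.*-identityʳ (x ^ e))))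
                    (ΣE-pow≡A1 i x)

C3-at-1-1 : ∀ j x → C3 j x (+ 1) (+ 1) ≡ A1 j x
C3-at-1-1 j x = trans (ΣC-cong j pointwise) (ΣE-pow≡A1 j x)
  where
  pointwise : ∀ e d f → x ^ e * (+ 1) ^ d * (+ 1) ^ f ≡ x ^ e
  pointwise e d f rewrite ℤ.^-zeroˡ d | ℤ.^-zeroˡ f = trans (ℤ.*-identityʳ _) (ℤ.*-identityʳ _)

C3-at-1-0 : ∀ j x → C3 j x (+ 1) (+ 0) ≡ d1 j x
C3-at-1-0 j x = ΣC-cong j pointwise
  where
  pointwise : ∀ e d f → x ^ e * (+ 1) ^ d * (+ 0) ^ f ≡ (if f ≡ᵇ 0 then x ^ e else + 0)
  pointwise e d zero    rewrite ℤ.^-zeroˡ d = trans (ℤ.*-identityʳ _) (ℤ.*-identityʳ _)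
  pointwise e d (suc f) = ℤ.*-zeroʳ (x ^ e * (+ 1) ^ d)

proposition2p3 : (n : ℕ) (x y s : ℤ) →
    (A3 (suc n) x y s ≡ binomConv n (λ i → A2 i x y) (λ j → C3 j x y s))
    × (A3 (suc n) x y (- y) ≡ binomConv n (λ i → d2 i x y) (λ j → d2 j x y))
    × (A3 (suc n) x (+ 1) (+ 0) ≡ binomConv n (λ i → A1 i x) (λ j → d1 j x))
    × (A3 (suc n) x (+ 1) (+ 1) ≡ binomConv n (λ i → A1 i x) (λ j → A1 j x))
proposition2p3 n x y s =
    A3≡binomConv-A2-C3 n x y s
  , A3≡binomConv-d2-d2 n x y
  , trans (A3≡binomConv-A2-C3 n x (+ 1) (+ 0)) (binomConv-cong n (λ i → A2-at-1 i x) (λ j → C3-at-1-0 j x))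
  , trans (A3≡binomConv-A2-C3 n x (+ 1) (+ 1)) (binomConv-cong n (λ i → A2-at-1 i x) (λ j → C3-at-1-1 j x))
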